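{- Let $G$ be a graph with $\ell$ different degrees whose degree sequence is forcibly self-complementary. Then for every $i\in\{1,\dots,\ell\}\setminus\{\frac{\ell+1}{2}\}$, there is no 2-switch in $G$ that changes the number of edges in $S_i$ or the number of edges between $V_i$ and $V_{\ell+1-i}$.
   Context: Graphs are finite and simple; a graph is self-complementary if it is isomorphic to its complement. A degree sequence is forcibly self-complementary if every graph with that degree sequence is self-complementary. With the distinct degrees of $G$ being $d_1>\dots>d_\ell$, $V_i=\{v: d(v)=d_i\}$ and $S_i=G[V_i\cup V_{\ell+1-i}]$ (the $i$th slice). A 2-switch: for four vertices $v_1,v_2,v_3,v_4$ with $v_1v_2, v_3v_4\in E(G)$ and $v_1v_3, v_2v_4\notin E(G)$, replace the edges $v_1v_2,v_3v_4$ by $v_1v_3,v_2v_4$ (this preserves all degrees). -}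

module Defs where

open import Data.Bool using (Bool; true; false; not; _∧_; _∨_; if_then_else_)
open import Data.Nat using (ℕ; zero; suc; _+_; _∸_; _<_; _≤_; _≡ᵇ_)
open import Data.Fin using (Fin; _<?_) renaming (_≟_ to _≟ᶠ_)
open import Data.List using (List; length; filterᵇ; concatMap; map)
open import Data.List using () renaming (allFin to allFinL)
open import Data.Product using (Σ; ∃; _×_; _,_)
open import Data.Fin.Permutation using (Permutation′; _⟨$⟩ʳ_)
open import Relation.Nullary.Decidable using (⌊_⌋)
open import Relation.Binary.PropositionalEquality using (_≡_; _≢_)

record Graph (n : ℕ) : Set where
  field
    adj   : Fin n → Fin n → Bool
    adj-sym : ∀ u v → adj u v ≡ adj v u
    adj-irrefl : ∀ v → adj v v ≡ false
open Graph public

countᵇ : {A : Set} → (A → Bool) → List A → ℕ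
countᵇ p xs = length (filterᵇ p xs)

deg : ∀ {n} → Graph n → Fin n → ℕ
deg {n} G v = countᵇ (λ u → adj G v u) (allFinL n)

complement : ∀ {n} → Graph n → Graph n
complement {n} G = record
  { adj = λ u v → not ⌊ u ≟ᶠ v ⌋ ∧ not (adj G u v)
  ; adj-sym = symC
  ; adj-irrefl = irrC }
  where
  open import Relation.Binary.PropositionalEquality using (refl; sym)
  import Relation.Binary.PropositionalEquality
  open import Relation.Nullary using (yes; no)
  symC : ∀ u v → (not ⌊ u ≟ᶠ v ⌋ ∧ not (adj G u v)) ≡ (not ⌊ v ≟ᶠ u ⌋ ∧ not (adj G v u))
  symC u v with u ≟ᶠ v | v ≟ᶠ u
  ... | yes _ | yes _ = refl
  ... | no _  | no _  = Relation.Binary.PropositionalEquality.cong (λ b → not b) (adj-sym G u v)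
  ... | yes p | no q  = Data.Empty.⊥-elim (q (sym p)) where import Data.Empty
  ... | no q  | yes p = Data.Empty.⊥-elim (q (sym p)) where import Data.Empty
  irrC : ∀ v → (not ⌊ v ≟ᶠ v ⌋ ∧ not (adj G v v)) ≡ false
  irrC v with v ≟ᶠ v
  ... | yes _ = refl
  ... | no ¬p = Data.Empty.⊥-elim (¬p refl) where import Data.Empty

_≅_ : ∀ {n} → Graph n → Graph n → Set
_≅_ {n} G H = Σ (Permutation′ n) λ σ → ∀ u v → adj H (σ ⟨$⟩ʳ u) (σ ⟨$⟩ʳ v) ≡ adj G u v

SelfComplementary : ∀ {n} → Graph n → Set
SelfComplementary G = G ≅ complement G

-- A degree sequence d (listed on n positions; its order is irrelevant) is
-- forcibly self-complementary if every graph having that degree sequence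
-- (i.e. degrees equal to d up to a reordering) is self-complementary.
ForciblySelfComplementary : ∀ {n} → (Fin n → ℕ) → Set
ForciblySelfComplementary {n} d =
  ∀ (H : Graph n) → (Σ (Permutation′ n) λ σ → ∀ v → deg H (σ ⟨$⟩ʳ v) ≡ d v) →
  SelfComplementary H

-- ℓ distinct degrees d₁ > … > d_ℓ (indices 1..ℓ, values of dd outside this range irrelevant):
-- dd is strictly decreasing on 1..ℓ, every vertex degree is some d_i, every d_i occurs.
DistinctDegrees : ∀ {n} → Graph n → (ℓ : ℕ) → (ℕ → ℕ) → Set
DistinctDegrees {n} G ℓ dd =
    (∀ i j → 1 ≤ i → i < j → j ≤ ℓ → dd j < dd i)
  × (∀ v → Σ ℕ λ i → 1 ≤ i × i ≤ ℓ × deg G v ≡ dd i)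
  × (∀ i → 1 ≤ i → i ≤ ℓ → Σ (Fin n) λ v → deg G v ≡ dd i)

inV : ∀ {n} → Graph n → (ℕ → ℕ) → ℕ → Fin n → Bool
inV G dd i v = deg G v ≡ᵇ dd i

pairs : (n : ℕ) → List (Fin n × Fin n)
pairs n = filterᵇ (λ { (u , v) → ⌊ u <? v ⌋ })
            (concatMap (λ u → map (λ v → (u , v)) (allFinL n)) (allFinL n))

edgesIn : ∀ {n} → (Fin n → Fin n → Bool) → (Fin n → Bool) → ℕ
edgesIn {n} A S = countᵇ (λ { (u , v) → S u ∧ S v ∧ A u v }) (pairs n)

edgesBetween : ∀ {n} → (Fin n → Fin n → Bool) → (Fin n → Bool) → (Fin n → Bool) → ℕ
edgesBetween {n} A P Q =
  countᵇ (λ { (u , v) → ((P u ∧ Q v) ∨ (Q u ∧ P v)) ∧ A u v }) (pairs n)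

-- number of edges of the slice S_i = G[V_i ∪ V_{ℓ+1-i}], measured in adjacency A
sliceEdges : ∀ {n} → Graph n → (ℓ : ℕ) → (ℕ → ℕ) → ℕ → (Fin n → Fin n → Bool) → ℕ
sliceEdges G ℓ dd i A = edgesIn A (λ v → inV G dd i v ∨ inV G dd (suc ℓ ∸ i) v)

crossEdges : ∀ {n} → Graph n → (ℓ : ℕ) → (ℕ → ℕ) → ℕ → (Fin n → Fin n → Bool) → ℕ
crossEdges G ℓ dd i A = edgesBetween A (inV G dd i) (inV G dd (suc ℓ ∸ i))

Is2Switch : ∀ {n} → Graph n → Fin n → Fin n → Fin n → Fin n → Set
Is2Switch G v₁ v₂ v₃ v₄ =
    v₁ ≢ v₂ × v₁ ≢ v₃ × v₁ ≢ v₄ × v₂ ≢ v₃ × v₂ ≢ v₄ × v₃ ≢ v₄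
  × adj G v₁ v₂ ≡ true × adj G v₃ v₄ ≡ true
  × adj G v₁ v₃ ≡ false × adj G v₂ v₄ ≡ false

samePair : ∀ {n} → Fin n → Fin n → Fin n → Fin n → Bool
samePair a b u v = (⌊ a ≟ᶠ u ⌋ ∧ ⌊ b ≟ᶠ v ⌋) ∨ (⌊ a ≟ᶠ v ⌋ ∧ ⌊ b ≟ᶠ u ⌋)

switchAdj : ∀ {n} → Graph n → Fin n → Fin n → Fin n → Fin n → Fin n → Fin n → Bool
switchAdj G v₁ v₂ v₃ v₄ u v =
  if samePair v₁ v₂ u v ∨ samePair v₃ v₄ u v then false
  else if samePair v₁ v₃ u v ∨ samePair v₂ v₄ u v then true
  else adj G u v

{-# OPTIONS --safe #-}
-- Every graph K with the degree sequence of G is self-complementary, and an isomorphism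
-- σ : K ≅ complement K satisfies d(σ u) + d(u) = n - 1. As d₁ > … > d_ℓ, the pairing of degree
-- classes this induces is order-reversing, hence it is k ↦ ℓ + 1 - k: σ exchanges V_i and
-- V_{ℓ+1-i}. So σ permutes the vertex pairs inside S_i (and those between V_i and V_{ℓ+1-i})
-- while exchanging edges and non-edges of K; hence exactly half of these pairs are edges of K.
-- That count depends on the degrees alone, and a 2-switch changes no degree.
module Submission where

open import Defs
open import Data.Bool using (Bool; true; false; not; _∧_; _∨_; if_then_else_)
open import Data.Bool.Properties using (∧-comm; ∧-assoc; ∨-comm; ∧-zeroʳ; ∧-identityʳ; ∨-identityʳ)
open import Data.Fin using (Fin; zero; suc; punchIn; _<?_) renaming (_≟_ to _≟ᶠ_)
open import Data.Fin.Permutation using (Permutation′; _⟨$⟩ʳ_; transpose) renaming (id to idₚ)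
import Data.Fin.Properties as Finₚ
open import Data.List using (List; []; _∷_; length; filterᵇ; concatMap; map; tabulate; _++_)
open import Data.List.Properties using (length-++; filter-++; map-tabulate)
open import Data.Nat using (ℕ; zero; suc; _+_; _∸_; _*_; _≤_; _<_; _≡ᵇ_; z≤n; s≤s)
open import Data.Nat.Properties hiding (_<?_)
open import Data.Product using (∃-syntax; _×_; _,_; proj₁; uncurry)
open import Function using (_∘_; id)
open import Relation.Binary.PropositionalEquality
open import Relation.Binary using (tri<; tri≈; tri>)
open import Relation.Nullary using (Dec; yes; no; ¬_; contradiction)
open import Relation.Nullary.Decidable using (⌊_⌋; dec-true; dec-false; does-⇔)
open import Function.Bundles using (mk⇔)

open import Algebra.Properties.CommutativeMonoid.Sum +-0-commutativeMonoid
  using (sum-syntax; sum-cong-≗; ∑-distrib-+; ∑-comm; sum-permute; sum-remove)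

toℕ : Bool → ℕ
toℕ true  = 1
toℕ false = 0

⌊⌋-true : ∀ {A : Set} (a? : Dec A) → A → ⌊ a? ⌋ ≡ true
⌊⌋-true (yes _) _ = refl
⌊⌋-true (no ¬a) a = contradiction a ¬a

⌊⌋-false : ∀ {A : Set} (a? : Dec A) → ¬ A → ⌊ a? ⌋ ≡ false
⌊⌋-false (yes a) ¬a = contradiction a ¬a
⌊⌋-false (no _)  _  = refl

∑-const : ∀ n c → ∑[ _ < n ] c ≡ n * c
∑-const zero    c = refl
∑-const (suc n) c = cong (c +_) (∑-const n c)

+-double-injective : ∀ {x y} → x + x ≡ y + y → x ≡ y
+-double-injective {x} {y} e = *-cancelˡ-≡ x y 2 (begin
  x + (x + 0) ≡⟨ cong (x +_) (+-identityʳ x) ⟩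
  x + x       ≡⟨ e ⟩
  y + y       ≡⟨ cong (y +_) (+-identityʳ y) ⟨
  y + (y + 0) ∎)
  where open ≡-Reasoning

+-≡⇒<ʳ : ∀ {a b c d} → a + b ≡ c + d → c < a → b < d
+-≡⇒<ʳ e c<a = ≰⇒> λ d≤b → <-irrefl (sym e) (+-mono-<-≤ c<a d≤b)

≡ᵇ-complementary : ∀ {n a b c d} → suc (a + b) ≡ n → suc (c + d) ≡ n → (b ≡ᵇ c) ≡ (a ≡ᵇ d)
≡ᵇ-complementary {a = a} {b} {c} {d} ab cd = does-⇔ (mk⇔ b≡c⇒a≡d a≡d⇒b≡c) (b ≟ c) (a ≟ d)
  where
  a+b≡c+d : a + b ≡ c + d
  a+b≡c+d = suc-injective (trans ab (sym cd))
  b≡c⇒a≡d : b ≡ c → a ≡ d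
  b≡c⇒a≡d refl = +-cancelʳ-≡ b a d (trans a+b≡c+d (+-comm b d))
  a≡d⇒b≡c : a ≡ d → b ≡ c
  a≡d⇒b≡c refl = +-cancelˡ-≡ a b c (trans a+b≡c+d (+-comm c a))

∨-≡ˡ : ∀ {x y c} → x ≡ c → y ≡ false → x ∨ y ≡ c
∨-≡ˡ refl refl = ∨-identityʳ _

∨-≡ʳ : ∀ {x y c} → x ≡ false → y ≡ c → x ∨ y ≡ c
∨-≡ʳ refl refl = refl

module _ {A : Set} where

  countᵇ-++ : ∀ (p : A → Bool) xs ys → countᵇ p (xs ++ ys) ≡ countᵇ p xs + countᵇ p ys
  countᵇ-++ p xs ys = trans (cong length (filter-++ _ xs ys)) (length-++ (filterᵇ p xs))

  countᵇ-filterᵇ : ∀ (p q : A → Bool) xs → countᵇ p (filterᵇ q xs) ≡ countᵇ (λ x → q x ∧ p x) xs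
  countᵇ-filterᵇ p q [] = refl
  countᵇ-filterᵇ p q (x ∷ xs) with q x
  ... | false = countᵇ-filterᵇ p q xs
  ... | true with p x
  ...   | true  = cong suc (countᵇ-filterᵇ p q xs)
  ...   | false = countᵇ-filterᵇ p q xs

  countᵇ-tabulate : ∀ {n} (p : A → Bool) (f : Fin n → A) →
    countᵇ p (tabulate f) ≡ ∑[ i < n ] toℕ (p (f i))
  countᵇ-tabulate {zero}  p f = refl
  countᵇ-tabulate {suc n} p f with p (f zero)
  ... | true  = cong suc (countᵇ-tabulate p (f ∘ suc))
  ... | false = countᵇ-tabulate p (f ∘ suc)

  countᵇ-concatMap-tabulate : ∀ {B : Set} {n} (p : A → Bool) (g : B → List A) (f : Fin n → B) →
    countᵇ p (concatMap g (tabulate f)) ≡ ∑[ i < n ] countᵇ p (g (f i))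
  countᵇ-concatMap-tabulate {n = zero}  p g f = refl
  countᵇ-concatMap-tabulate {n = suc n} p g f =
    trans (countᵇ-++ p (g (f zero)) _) (cong (_ +_) (countᵇ-concatMap-tabulate p g (f ∘ suc)))

EdgeSet : ℕ → Set
EdgeSet n = Fin n → Fin n → Bool

module _ {n : ℕ} where

  infixr 6 _∩_
  _∩_ : EdgeSet n → EdgeSet n → EdgeSet n
  (M ∩ A) u v = M u v ∧ A u v

  Symmetric Irreflexive : EdgeSet n → Set
  Symmetric R   = ∀ u v → R u v ≡ R v u
  Irreflexive R = ∀ u → R u u ≡ false

  Invariant : Permutation′ n → EdgeSet n → Set
  Invariant σ M = ∀ u v → M (σ ⟨$⟩ʳ u) (σ ⟨$⟩ʳ v) ≡ M u v

  Swaps : Permutation′ n → (Fin n → Bool) → (Fin n → Bool) → Set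
  Swaps σ P Q = (∀ u → P (σ ⟨$⟩ʳ u) ≡ Q u) × (∀ u → Q (σ ⟨$⟩ʳ u) ≡ P u)

  pairCount : EdgeSet n → ℕ
  pairCount R = ∑[ u < n ] ∑[ v < n ] toℕ (R u v)

  edgeCount : EdgeSet n → ℕ
  edgeCount R = countᵇ (uncurry R) (pairs n)

  _<ᵇ_ : Fin n → Fin n → Bool
  u <ᵇ v = ⌊ u <? v ⌋

  edgeCount-∑ : ∀ R → edgeCount R ≡ ∑[ u < n ] ∑[ v < n ] toℕ (u <ᵇ v ∧ R u v)
  edgeCount-∑ R = begin
    edgeCount R
      ≡⟨ countᵇ-filterᵇ (uncurry R) (uncurry _<ᵇ_) (concatMap row (tabulate id)) ⟩
    countᵇ (λ (u , v) → u <ᵇ v ∧ R u v) (concatMap row (tabulate id))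
      ≡⟨ countᵇ-concatMap-tabulate _ row id ⟩
    ∑[ u < n ] countᵇ (λ (u , v) → u <ᵇ v ∧ R u v) (row u)
      ≡⟨ sum-cong-≗ {n} (λ u → cong (countᵇ _) (map-tabulate {n = n} id (u ,_))) ⟩
    ∑[ u < n ] countᵇ (λ (u , v) → u <ᵇ v ∧ R u v) (tabulate (u ,_))
      ≡⟨ sum-cong-≗ {n} (λ u → countᵇ-tabulate {n = n} _ (u ,_)) ⟩
    ∑[ u < n ] ∑[ v < n ] toℕ (u <ᵇ v ∧ R u v) ∎
    where
    open ≡-Reasoning
    row : Fin n → List (Fin n × Fin n)
    row u = map (u ,_) (tabulate id)

  toℕ-split-< : ∀ R → Irreflexive R → ∀ u v →
    toℕ (R u v) ≡ toℕ (u <ᵇ v ∧ R u v) + toℕ (v <ᵇ u ∧ R u v)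
  toℕ-split-< R irr u v with R u v in Ruv
  ... | false rewrite ∧-zeroʳ (u <ᵇ v) | ∧-zeroʳ (v <ᵇ u) = refl
  ... | true rewrite ∧-identityʳ (u <ᵇ v) | ∧-identityʳ (v <ᵇ u) with Finₚ.<-cmp u v
  ...   | tri< u<v _ v≮u rewrite ⌊⌋-true (u <? v) u<v | ⌊⌋-false (v <? u) v≮u = refl
  ...   | tri> u≮v _ v<u rewrite ⌊⌋-false (u <? v) u≮v | ⌊⌋-true (v <? u) v<u = refl
  ...   | tri≈ _ refl _ with () ← trans (sym Ruv) (irr u)

  pairCount≡edgeCount+edgeCount : ∀ R → Irreflexive R → Symmetric R →
    pairCount R ≡ edgeCount R + edgeCount R
  pairCount≡edgeCount+edgeCount R irr sym-R = begin
    pairCount R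
      ≡⟨ sum-cong-≗ {n} (λ u → sum-cong-≗ {n} (toℕ-split-< R irr u)) ⟩
    ∑[ u < n ] ∑[ v < n ] (toℕ (u <ᵇ v ∧ R u v) + toℕ (v <ᵇ u ∧ R u v))
      ≡⟨ sum-cong-≗ {n} (λ u → ∑-distrib-+ (λ v → toℕ (u <ᵇ v ∧ R u v)) _) ⟩
    ∑[ u < n ] (∑[ v < n ] toℕ (u <ᵇ v ∧ R u v) + ∑[ v < n ] toℕ (v <ᵇ u ∧ R u v))
      ≡⟨ ∑-distrib-+ (λ u → ∑[ v < n ] toℕ (u <ᵇ v ∧ R u v)) _ ⟩
    E + ∑[ u < n ] ∑[ v < n ] toℕ (v <ᵇ u ∧ R u v)
      ≡⟨ cong (E +_) (∑-comm (λ u v → toℕ (v <ᵇ u ∧ R u v))) ⟩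
    E + ∑[ v < n ] ∑[ u < n ] toℕ (v <ᵇ u ∧ R u v)
      ≡⟨ cong (E +_) (sum-cong-≗ {n} λ v → sum-cong-≗ {n} λ u →
           cong (λ b → toℕ (v <ᵇ u ∧ b)) (sym-R u v)) ⟩
    E + ∑[ v < n ] ∑[ u < n ] toℕ (v <ᵇ u ∧ R v u)
      ≡⟨ sym (cong₂ _+_ (edgeCount-∑ R) (edgeCount-∑ R)) ⟩
    edgeCount R + edgeCount R ∎
    where
    open ≡-Reasoning
    E : ℕ
    E = ∑[ u < n ] ∑[ v < n ] toℕ (u <ᵇ v ∧ R u v)

  edgeCount-cong : ∀ {R R′ : EdgeSet n} → (∀ u v → R u v ≡ R′ u v) → edgeCount R ≡ edgeCount R′
  edgeCount-cong {R} {R′} R≡R′ = begin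
    edgeCount R
      ≡⟨ edgeCount-∑ R ⟩
    ∑[ u < n ] ∑[ v < n ] toℕ (u <ᵇ v ∧ R u v)
      ≡⟨ sum-cong-≗ {n} (λ u → sum-cong-≗ {n} λ v → cong (λ b → toℕ (u <ᵇ v ∧ b)) (R≡R′ u v)) ⟩
    ∑[ u < n ] ∑[ v < n ] toℕ (u <ᵇ v ∧ R′ u v)
      ≡⟨ edgeCount-∑ R′ ⟨
    edgeCount R′ ∎
    where open ≡-Reasoning

distinct : ∀ {n} → EdgeSet n
distinct u v = not ⌊ u ≟ᶠ v ⌋

∑-distinct : ∀ {n} (v : Fin n) → suc (∑[ w < n ] toℕ (distinct v w)) ≡ n
∑-distinct {suc m} v = begin
  suc (∑[ w < suc m ] toℕ (distinct v w))
    ≡⟨ cong suc (sum-remove {i = v} (toℕ ∘ distinct v)) ⟩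
  suc (toℕ (distinct v v) + ∑[ j < m ] toℕ (distinct v (punchIn v j)))
    ≡⟨ cong suc (cong₂ _+_ v≡v (sum-cong-≗ {m} v≢punchIn)) ⟩
  suc (∑[ _ < m ] 1)
    ≡⟨ cong suc (trans (∑-const m 1) (*-identityʳ m)) ⟩
  suc m ∎
  where
  open ≡-Reasoning
  v≡v : toℕ (distinct v v) ≡ 0
  v≡v = cong (toℕ ∘ not) (⌊⌋-true (v ≟ᶠ v) refl)
  v≢punchIn : ∀ j → toℕ (distinct v (punchIn v j)) ≡ 1
  v≢punchIn j = cong (toℕ ∘ not) (⌊⌋-false (v ≟ᶠ _) (Finₚ.punchInᵢ≢i v j ∘ sym))

module _ {n : ℕ} where

  complement-partition : ∀ (K : Graph n) m u v →
    toℕ (m ∧ adj (complement K) u v) + toℕ (m ∧ adj K u v) ≡ toℕ (m ∧ distinct u v)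
  complement-partition K false u v = refl
  complement-partition K true  u v with u ≟ᶠ v
  ... | yes refl rewrite adj-irrefl K u = refl
  ... | no _ with adj K u v
  ...   | true  = refl
  ...   | false = refl

  deg-∑ : ∀ (K : Graph n) v → deg K v ≡ ∑[ w < n ] toℕ (adj K v w)
  deg-∑ K v = countᵇ-tabulate (adj K v) id

  deg-complement : ∀ (K : Graph n) v → suc (deg (complement K) v + deg K v) ≡ n
  deg-complement K v = begin
    suc (deg (complement K) v + deg K v)
      ≡⟨ cong suc (cong₂ _+_ (deg-∑ (complement K) v) (deg-∑ K v)) ⟩
    suc (∑[ w < n ] toℕ (adj (complement K) v w) + ∑[ w < n ] toℕ (adj K v w))
      ≡⟨ cong suc (sym (∑-distrib-+ (toℕ ∘ adj (complement K) v) _)) ⟩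
    suc (∑[ w < n ] (toℕ (adj (complement K) v w) + toℕ (adj K v w)))
      ≡⟨ cong suc (sum-cong-≗ {n} (complement-partition K true v)) ⟩
    suc (∑[ w < n ] toℕ (distinct v w))
      ≡⟨ ∑-distinct v ⟩
    n ∎
    where open ≡-Reasoning

  ≅-deg : ∀ {G H : Graph n} ((σ , _) : G ≅ H) u → deg H (σ ⟨$⟩ʳ u) ≡ deg G u
  ≅-deg {G} {H} (σ , iso) u = begin
    deg H (σ ⟨$⟩ʳ u)                                ≡⟨ deg-∑ H _ ⟩
    ∑[ w < n ] toℕ (adj H (σ ⟨$⟩ʳ u) w)            ≡⟨ sum-permute _ σ ⟩
    ∑[ w < n ] toℕ (adj H (σ ⟨$⟩ʳ u) (σ ⟨$⟩ʳ w))   ≡⟨ sum-cong-≗ {n} (cong toℕ ∘ iso u) ⟩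
    ∑[ w < n ] toℕ (adj G u w)                      ≡⟨ deg-∑ G u ⟨
    deg G u ∎
    where open ≡-Reasoning

  selfComplementary-deg : ∀ {K : Graph n} ((σ , _) : SelfComplementary K) u →
    suc (deg K u + deg K (σ ⟨$⟩ʳ u)) ≡ n
  selfComplementary-deg {K} sc@(σ , _) u =
    trans (cong (λ d → suc (d + deg K (σ ⟨$⟩ʳ u))) (sym (≅-deg {K} {complement K} sc u)))
          (deg-complement K (σ ⟨$⟩ʳ u))

  ≅-pairCount : ∀ {G H : Graph n} ((σ , _) : G ≅ H) M → Invariant σ M →
    pairCount (M ∩ adj H) ≡ pairCount (M ∩ adj G)
  ≅-pairCount {G} {H} (σ , iso) M inv = begin
    pairCount (M ∩ adj H)
      ≡⟨ sum-permute _ σ ⟩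
    ∑[ u < n ] ∑[ v < n ] toℕ ((M ∩ adj H) (σ ⟨$⟩ʳ u) v)
      ≡⟨ sum-cong-≗ {n} (λ u → sum-permute _ σ) ⟩
    ∑[ u < n ] ∑[ v < n ] toℕ ((M ∩ adj H) (σ ⟨$⟩ʳ u) (σ ⟨$⟩ʳ v))
      ≡⟨ sum-cong-≗ {n} (λ u → sum-cong-≗ {n} λ v → cong toℕ (cong₂ _∧_ (inv u v) (iso u v))) ⟩
    pairCount (M ∩ adj G) ∎
    where open ≡-Reasoning

  complement-pairCount : ∀ (K : Graph n) M →
    pairCount (M ∩ adj (complement K)) + pairCount (M ∩ adj K) ≡ pairCount (M ∩ distinct)
  complement-pairCount K M =
    trans (sym (∑-distrib-+ (λ u → ∑[ v < n ] toℕ ((M ∩ adj (complement K)) u v)) _))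
      (sum-cong-≗ {n} λ u →
        trans (sym (∑-distrib-+ (λ v → toℕ ((M ∩ adj (complement K)) u v)) _))
          (sum-cong-≗ {n} λ v → complement-partition K (M u v) u v))

  selfComplementary-pairCount : ∀ {K : Graph n} ((σ , _) : SelfComplementary K) M → Invariant σ M →
    pairCount (M ∩ adj K) + pairCount (M ∩ adj K) ≡ pairCount (M ∩ distinct)
  selfComplementary-pairCount {K} sc M inv =
    trans (cong (_+ pairCount (M ∩ adj K)) (sym (≅-pairCount {K} {complement K} sc M inv)))
          (complement-pairCount K M)

  ∩-adj-irreflexive : ∀ M (K : Graph n) → Irreflexive (M ∩ adj K)
  ∩-adj-irreflexive M K u rewrite adj-irrefl K u = ∧-zeroʳ (M u u)

  ∩-adj-symmetric : ∀ {M} (K : Graph n) → Symmetric M → Symmetric (M ∩ adj K)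
  ∩-adj-symmetric K sym-M u v = cong₂ _∧_ (sym-M u v) (adj-sym K u v)

  selfComplementary-edgeCount : ∀ {K₁ K₂ : Graph n}
    ((σ₁ , _) : SelfComplementary K₁) ((σ₂ , _) : SelfComplementary K₂) M →
    Symmetric M → Invariant σ₁ M → Invariant σ₂ M →
    edgeCount (M ∩ adj K₁) ≡ edgeCount (M ∩ adj K₂)
  selfComplementary-edgeCount {K₁} {K₂} sc₁ sc₂ M sym-M inv₁ inv₂ =
    +-double-injective (begin
      edgeCount (M ∩ adj K₁) + edgeCount (M ∩ adj K₁)  ≡⟨ doubled K₁ ⟨
      pairCount (M ∩ adj K₁)                           ≡⟨ +-double-injective pairCounts ⟩
      pairCount (M ∩ adj K₂)                           ≡⟨ doubled K₂ ⟩
      edgeCount (M ∩ adj K₂) + edgeCount (M ∩ adj K₂)  ∎)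
    where
    open ≡-Reasoning
    doubled : ∀ K → pairCount (M ∩ adj K) ≡ edgeCount (M ∩ adj K) + edgeCount (M ∩ adj K)
    doubled K = pairCount≡edgeCount+edgeCount _ (∩-adj-irreflexive M K) (∩-adj-symmetric K sym-M)
    pairCounts : pairCount (M ∩ adj K₁) + pairCount (M ∩ adj K₁)
               ≡ pairCount (M ∩ adj K₂) + pairCount (M ∩ adj K₂)
    pairCounts = trans (selfComplementary-pairCount {K = K₁} sc₁ M inv₁)
                       (sym (selfComplementary-pairCount {K = K₂} sc₂ M inv₂))

module _ {n : ℕ} where

  samePair-sym : ∀ (a b u v : Fin n) → samePair a b u v ≡ samePair a b v u
  samePair-sym a b u v = ∨-comm (⌊ a ≟ᶠ u ⌋ ∧ ⌊ b ≟ᶠ v ⌋) _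

  samePair-diag : ∀ {a b : Fin n} → a ≢ b → ∀ u → samePair a b u u ≡ false
  samePair-diag {a} {b} a≢b u with a ≟ᶠ u | b ≟ᶠ u
  ... | yes refl | yes refl = contradiction refl a≢b
  ... | yes _    | no _     = refl
  ... | no _     | yes _    = refl
  ... | no _     | no _     = refl

  samePair-fst : ∀ {a b : Fin n} → a ≢ b → ∀ v → samePair a b a v ≡ ⌊ b ≟ᶠ v ⌋
  samePair-fst {a} {b} a≢b v
    rewrite ⌊⌋-true (a ≟ᶠ a) refl | ⌊⌋-false (b ≟ᶠ a) (a≢b ∘ sym) | ∧-zeroʳ ⌊ a ≟ᶠ v ⌋ =
    ∨-identityʳ ⌊ b ≟ᶠ v ⌋

  samePair-snd : ∀ {a b : Fin n} → a ≢ b → ∀ v → samePair a b b v ≡ ⌊ a ≟ᶠ v ⌋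
  samePair-snd {a} {b} a≢b v
    rewrite ⌊⌋-false (a ≟ᶠ b) a≢b | ⌊⌋-true (b ≟ᶠ b) refl = ∧-identityʳ ⌊ a ≟ᶠ v ⌋

  samePair-other : ∀ {a b u : Fin n} → u ≢ a → u ≢ b → ∀ v → samePair a b u v ≡ false
  samePair-other {a} {b} {u} u≢a u≢b v
    rewrite ⌊⌋-false (a ≟ᶠ u) (u≢a ∘ sym) | ⌊⌋-false (b ≟ᶠ u) (u≢b ∘ sym) = ∧-zeroʳ ⌊ a ≟ᶠ v ⌋

  replaceNeighbour : Fin n → Fin n → (Fin n → Bool) → Fin n → Bool
  replaceNeighbour a b r w = if ⌊ a ≟ᶠ w ⌋ then false else if ⌊ b ≟ᶠ w ⌋ then true else r w

  replaceNeighbour-transpose : ∀ {a b : Fin n} {r} → a ≢ b → r a ≡ true → r b ≡ false →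
    ∀ w → replaceNeighbour a b r w ≡ r (transpose a b ⟨$⟩ʳ w)
  replaceNeighbour-transpose {a} {b} {r} a≢b ra rb w with w ≟ᶠ a | w ≟ᶠ b
  ... | yes refl | _ rewrite ⌊⌋-true (a ≟ᶠ a) refl = sym rb
  ... | no w≢a | yes refl
    rewrite ⌊⌋-false (a ≟ᶠ b) a≢b | ⌊⌋-true (b ≟ᶠ b) refl | dec-true (b ≟ᶠ b) refl = sym ra
  ... | no w≢a | no w≢b
    rewrite ⌊⌋-false (a ≟ᶠ w) (w≢a ∘ sym) | ⌊⌋-false (b ≟ᶠ w) (w≢b ∘ sym)
          | dec-false (w ≟ᶠ b) w≢b = refl

  replaceNeighbour-count : ∀ {a b : Fin n} {r} → a ≢ b → r a ≡ true → r b ≡ false →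
    ∑[ w < n ] toℕ (replaceNeighbour a b r w) ≡ ∑[ w < n ] toℕ (r w)
  replaceNeighbour-count {a} {b} {r} a≢b ra rb =
    trans (sum-cong-≗ {n} (cong toℕ ∘ replaceNeighbour-transpose a≢b ra rb))
          (sym (sum-permute (toℕ ∘ r) (transpose a b)))

switched : ∀ {n} (G : Graph n) {v₁ v₂ v₃ v₄} → Is2Switch G v₁ v₂ v₃ v₄ → Graph n
switched G {v₁} {v₂} {v₃} {v₄} (v₁≢v₂ , v₁≢v₃ , _ , _ , v₂≢v₄ , v₃≢v₄ , _) = record
  { adj = switchAdj G v₁ v₂ v₃ v₄ ; adj-sym = switch-sym ; adj-irrefl = switch-irrefl }
  where
  switch-sym : ∀ u v → switchAdj G v₁ v₂ v₃ v₄ u v ≡ switchAdj G v₁ v₂ v₃ v₄ v u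
  switch-sym u v
    rewrite samePair-sym v₁ v₂ u v | samePair-sym v₃ v₄ u v
          | samePair-sym v₁ v₃ u v | samePair-sym v₂ v₄ u v | adj-sym G u v = refl
  switch-irrefl : ∀ u → switchAdj G v₁ v₂ v₃ v₄ u u ≡ false
  switch-irrefl u
    rewrite samePair-diag v₁≢v₂ u | samePair-diag v₃≢v₄ u
          | samePair-diag v₁≢v₃ u | samePair-diag v₂≢v₄ u = adj-irrefl G u

module _ {n} (G : Graph n) {v₁ v₂ v₃ v₄} (sw : Is2Switch G v₁ v₂ v₃ v₄) where

  private
    H = switched G sw

  deg-switched-unchanged : ∀ {u} → (∀ w → adj H u w ≡ adj G u w) → deg H u ≡ deg G u
  deg-switched-unchanged {u} row =
    trans (deg-∑ H u) (trans (sum-cong-≗ {n} (cong toℕ ∘ row)) (sym (deg-∑ G u)))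

  deg-switched-replaced : ∀ {u a b} → a ≢ b → adj G u a ≡ true → adj G u b ≡ false →
    (∀ w → samePair v₁ v₂ u w ∨ samePair v₃ v₄ u w ≡ ⌊ a ≟ᶠ w ⌋) →
    (∀ w → samePair v₁ v₃ u w ∨ samePair v₂ v₄ u w ≡ ⌊ b ≟ᶠ w ⌋) →
    deg H u ≡ deg G u
  deg-switched-replaced {u} {a} {b} a≢b ua ub removed added = begin
    deg H u                                               ≡⟨ deg-∑ H u ⟩
    ∑[ w < n ] toℕ (adj H u w)                            ≡⟨ sum-cong-≗ {n} (cong toℕ ∘ row) ⟩
    ∑[ w < n ] toℕ (replaceNeighbour a b (adj G u) w)     ≡⟨ replaceNeighbour-count a≢b ua ub ⟩
    ∑[ w < n ] toℕ (adj G u w)                            ≡⟨ deg-∑ G u ⟨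
    deg G u ∎
    where
    open ≡-Reasoning
    row : ∀ w → adj H u w ≡ replaceNeighbour a b (adj G u) w
    row w rewrite removed w | added w = refl

deg-switched : ∀ {n} (G : Graph n) {v₁ v₂ v₃ v₄} (sw : Is2Switch G v₁ v₂ v₃ v₄) →
  ∀ v → deg (switched G sw) v ≡ deg G v
deg-switched {n} G {v₁} {v₂} {v₃} {v₄}
  sw@(v₁≢v₂ , v₁≢v₃ , v₁≢v₄ , v₂≢v₃ , v₂≢v₄ , v₃≢v₄ , v₁v₂ , v₃v₄ , v₁≁v₃ , v₂≁v₄) v
  with v ≟ᶠ v₁ | v ≟ᶠ v₂ | v ≟ᶠ v₃ | v ≟ᶠ v₄
... | yes refl | _ | _ | _ =
  deg-switched-replaced G sw v₂≢v₃ v₁v₂ v₁≁v₃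
    (λ w → ∨-≡ˡ (samePair-fst v₁≢v₂ w) (samePair-other v₁≢v₃ v₁≢v₄ w))
    (λ w → ∨-≡ˡ (samePair-fst v₁≢v₃ w) (samePair-other v₁≢v₂ v₁≢v₄ w))
... | no _ | yes refl | _ | _ =
  deg-switched-replaced G sw v₁≢v₄ (trans (adj-sym G v₂ v₁) v₁v₂) v₂≁v₄
    (λ w → ∨-≡ˡ (samePair-snd v₁≢v₂ w) (samePair-other v₂≢v₃ v₂≢v₄ w))
    (λ w → ∨-≡ʳ (samePair-other (v₁≢v₂ ∘ sym) v₂≢v₃ w) (samePair-fst v₂≢v₄ w))
... | no _ | no _ | yes refl | _ =
  deg-switched-replaced G sw (v₁≢v₄ ∘ sym) v₃v₄ (trans (adj-sym G v₃ v₁) v₁≁v₃)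
    (λ w → ∨-≡ʳ (samePair-other (v₁≢v₃ ∘ sym) (v₂≢v₃ ∘ sym) w) (samePair-fst v₃≢v₄ w))
    (λ w → ∨-≡ˡ (samePair-snd v₁≢v₃ w) (samePair-other (v₂≢v₃ ∘ sym) v₃≢v₄ w))
... | no _ | no _ | no _ | yes refl =
  deg-switched-replaced G sw (v₂≢v₃ ∘ sym)
    (trans (adj-sym G v₄ v₃) v₃v₄) (trans (adj-sym G v₄ v₂) v₂≁v₄)
    (λ w → ∨-≡ʳ (samePair-other (v₁≢v₄ ∘ sym) (v₂≢v₄ ∘ sym) w) (samePair-snd v₃≢v₄ w))
    (λ w → ∨-≡ʳ (samePair-other (v₁≢v₄ ∘ sym) (v₃≢v₄ ∘ sym) w) (samePair-snd v₂≢v₄ w))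
... | no v≢v₁ | no v≢v₂ | no v≢v₃ | no v≢v₄ = deg-switched-unchanged G sw λ w →
  cong₂ (λ x y → if x then false else if y then true else adj G v w)
    (∨-≡ʳ (samePair-other v≢v₁ v≢v₂ w) (samePair-other v≢v₃ v≢v₄ w))
    (∨-≡ʳ (samePair-other v≢v₁ v≢v₃ w) (samePair-other v≢v₂ v≢v₄ w))

Index : ℕ → ℕ → Set
Index ℓ k = 1 ≤ k × k ≤ ℓ

module _ (ℓ : ℕ) (R : ℕ → ℕ → Set)
  (partner : ∀ {k} → Index ℓ k → ∃[ j ] Index ℓ j × R j k)
  (antitone : ∀ {j k j′ k′} → Index ℓ j → Index ℓ k → Index ℓ j′ → Index ℓ k′ →
              k < k′ → R j k → R j′ k′ → j′ < j)
  where

  partner-+-≤ : ∀ m {j} → Index ℓ j → Index ℓ (suc m) → R j (suc m) → j + suc m ≤ suc ℓ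
  partner-+-≤ zero {j} (_ , j≤ℓ) _ _ = ≤-trans (≤-reflexive (+-comm j 1)) (s≤s j≤ℓ)
  partner-+-≤ (suc m) {j} Ij Ik@(_ , k≤ℓ) Rj =
    let j′ , Ij′ , Rj′ = partner Ism in begin
    j + suc (suc m)   ≡⟨ +-suc j (suc m) ⟩
    suc j + suc m     ≤⟨ +-monoˡ-≤ (suc m) (antitone Ij′ Ism Ij Ik ≤-refl Rj′ Rj) ⟩
    j′ + suc m        ≤⟨ partner-+-≤ m Ij′ Ism Rj′ ⟩
    suc ℓ             ∎
    where
    open ≤-Reasoning
    Ism : Index ℓ (suc m)
    Ism = s≤s z≤n , ≤-trans (n≤1+n (suc m)) k≤ℓ

  partner-+-≥ : ∀ d {j k} → k + d ≡ ℓ → Index ℓ j → Index ℓ k → R j k → suc ℓ ≤ j + k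
  partner-+-≥ zero {j} {k} k≡ℓ (1≤j , _) _ _ = begin
    suc ℓ     ≡⟨ cong suc (trans (sym (+-identityʳ k)) k≡ℓ) ⟨
    1 + k     ≤⟨ +-monoˡ-≤ k 1≤j ⟩
    j + k     ∎
    where open ≤-Reasoning
  partner-+-≥ (suc d) {j} {k} k+sd≡ℓ Ij Ik Rj =
    let j′ , Ij′ , Rj′ = partner Isk in begin
    suc ℓ             ≤⟨ partner-+-≥ d sk+d≡ℓ Ij′ Isk Rj′ ⟩
    j′ + suc k        ≡⟨ +-suc j′ k ⟩
    suc j′ + k        ≤⟨ +-monoˡ-≤ k (antitone Ij Ik Ij′ Isk ≤-refl Rj Rj′) ⟩
    j + k             ∎
    where
    open ≤-Reasoning
    sk+d≡ℓ : suc k + d ≡ ℓ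
    sk+d≡ℓ = trans (sym (+-suc k d)) k+sd≡ℓ
    Isk : Index ℓ (suc k)
    Isk = s≤s z≤n , subst (suc k ≤_) sk+d≡ℓ (m≤m+n (suc k) d)

  partner-+-≡ : ∀ {j k} → Index ℓ j → Index ℓ k → R j k → j + k ≡ suc ℓ
  partner-+-≡ {j} {suc m} Ij Ik@(_ , k≤ℓ) Rj =
    ≤-antisym (partner-+-≤ m Ij Ik Rj) (partner-+-≥ (ℓ ∸ suc m) (m+[n∸m]≡n k≤ℓ) Ij Ik Rj)

module _ {ℓ : ℕ} {dd : ℕ → ℕ} (decreasing : ∀ i j → 1 ≤ i → i < j → j ≤ ℓ → dd j < dd i) where

  decreasing-reflects-< : ∀ {j j′} → 1 ≤ j → j′ ≤ ℓ → dd j < dd j′ → j′ < j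
  decreasing-reflects-< {j} {j′} 1≤j j′≤ℓ dd-lt with <-cmp j j′
  ... | tri< j<j′ _ _ = contradiction dd-lt (<⇒≯ (decreasing j j′ 1≤j j<j′ j′≤ℓ))
  ... | tri≈ _ refl _ = contradiction dd-lt (<-irrefl refl)
  ... | tri> _ _ j′<j = j′<j

module _ {n} (G : Graph n) (ℓ : ℕ) (dd : ℕ → ℕ) (DD : DistinctDegrees G ℓ dd) where

  ComplementaryIndices : ℕ → ℕ → Set
  ComplementaryIndices j k = suc (dd k + dd j) ≡ n

  complementaryIndex-exists : SelfComplementary G →
    ∀ {k} → Index ℓ k → ∃[ j ] Index ℓ j × ComplementaryIndices j k
  complementaryIndex-exists sc@(σ , _) {k} (1≤k , k≤ℓ) =
    let _ , degreeOf , realised = DD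
        v , deg-v = realised k 1≤k k≤ℓ
        j , 1≤j , j≤ℓ , deg-σv = degreeOf (σ ⟨$⟩ʳ v)
    in j , (1≤j , j≤ℓ)
         , subst₂ (λ a b → suc (a + b) ≡ n) deg-v deg-σv (selfComplementary-deg {K = G} sc v)

  complementaryIndex-antitone : ∀ {j k j′ k′} → Index ℓ j → Index ℓ k → Index ℓ j′ → Index ℓ k′ →
    k < k′ → ComplementaryIndices j k → ComplementaryIndices j′ k′ → j′ < j
  complementaryIndex-antitone (1≤j , _) (1≤k , _) (_ , j′≤ℓ) (_ , k′≤ℓ) k<k′ Rjk Rj′k′ =
    decreasing-reflects-< decreasing 1≤j j′≤ℓ
      (+-≡⇒<ʳ (suc-injective (trans Rjk (sym Rj′k′))) (decreasing _ _ 1≤k k<k′ k′≤ℓ))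
    where decreasing = proj₁ DD

  complementaryDegrees : SelfComplementary G → ∀ {i} → Index ℓ i → suc (dd i + dd (suc ℓ ∸ i)) ≡ n
  complementaryDegrees sc {i} Ii =
    let j , Ij , Rji = complementaryIndex-exists sc Ii
        j+i≡ = partner-+-≡ ℓ ComplementaryIndices (complementaryIndex-exists sc)
                 complementaryIndex-antitone Ij Ii Rji
    in subst (λ j → suc (dd i + dd j) ≡ n) (j≡ j j+i≡) Rji
    where
    j≡ : ∀ j → j + i ≡ suc ℓ → j ≡ suc ℓ ∸ i
    j≡ j j+i≡ = trans (sym (m+n∸n≡m j i)) (cong (_∸ i) j+i≡)

degreeClasses-swap : ∀ {n} (G K : Graph n) (dd : ℕ → ℕ) ((σ , _) : SelfComplementary K) →
  (∀ v → deg K v ≡ deg G v) → ∀ {i j} → suc (dd i + dd j) ≡ n → Swaps σ (inV G dd i) (inV G dd j)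
degreeClasses-swap {n} G K dd sc@(σ , _) deg-K {i} {j} ij =
    (λ u → classSwap u ij)
  , (λ u → classSwap u (trans (cong suc (+-comm (dd j) (dd i))) ij))
  where
  degrees : ∀ u → suc (deg G u + deg G (σ ⟨$⟩ʳ u)) ≡ n
  degrees u = subst₂ (λ a b → suc (a + b) ≡ n) (deg-K u) (deg-K (σ ⟨$⟩ʳ u))
                (selfComplementary-deg {K = K} sc u)

  classSwap : ∀ u {c d} → suc (dd c + dd d) ≡ n → inV G dd c (σ ⟨$⟩ʳ u) ≡ inV G dd d u
  classSwap u = ≡ᵇ-complementary {a = deg G u} {b = deg G (σ ⟨$⟩ʳ u)} (degrees u)

module _ {n : ℕ} where

  sliceMask crossMask : (Fin n → Bool) → (Fin n → Bool) → EdgeSet n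
  sliceMask P Q u v = (P u ∨ Q u) ∧ (P v ∨ Q v)
  crossMask P Q u v = (P u ∧ Q v) ∨ (Q u ∧ P v)

  sliceMask-symmetric : ∀ P Q → Symmetric (sliceMask P Q)
  sliceMask-symmetric P Q u v = ∧-comm (P u ∨ Q u) (P v ∨ Q v)

  crossMask-symmetric : ∀ P Q → Symmetric (crossMask P Q)
  crossMask-symmetric P Q u v =
    trans (cong₂ _∨_ (∧-comm (P u) (Q v)) (∧-comm (Q u) (P v))) (∨-comm (Q v ∧ P u) (P v ∧ Q u))

  sliceMask-invariant : ∀ P Q σ → Swaps σ P Q → Invariant σ (sliceMask P Q)
  sliceMask-invariant P Q σ (P∘σ , Q∘σ) u v = cong₂ _∧_ (union u) (union v)
    where
    union : ∀ u → P (σ ⟨$⟩ʳ u) ∨ Q (σ ⟨$⟩ʳ u) ≡ P u ∨ Q u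
    union u = trans (cong₂ _∨_ (P∘σ u) (Q∘σ u)) (∨-comm (Q u) (P u))

  crossMask-invariant : ∀ P Q σ → Swaps σ P Q → Invariant σ (crossMask P Q)
  crossMask-invariant P Q σ (P∘σ , Q∘σ) u v =
    trans (cong₂ _∨_ (cong₂ _∧_ (P∘σ u) (Q∘σ v)) (cong₂ _∧_ (Q∘σ u) (P∘σ v)))
          (∨-comm (Q u ∧ P v) (P u ∧ Q v))

sliceEdges-edgeCount : ∀ {n} (G : Graph n) ℓ dd i A →
  sliceEdges G ℓ dd i A ≡ edgeCount (sliceMask (inV G dd i) (inV G dd (suc ℓ ∸ i)) ∩ A)
sliceEdges-edgeCount G ℓ dd i A = edgeCount-cong λ u v → sym (∧-assoc (S u) (S v) (A u v))
  where
  S : Fin _ → Bool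
  S v = inV G dd i v ∨ inV G dd (suc ℓ ∸ i) v

corollary17 : ∀ {n} (G : Graph n) (ℓ : ℕ) (dd : ℕ → ℕ) →
    DistinctDegrees G ℓ dd →
    ForciblySelfComplementary (deg G) →
    ∀ (i : ℕ) → 1 ≤ i → i ≤ ℓ → 2 * i ≢ suc ℓ →
    ∀ (v₁ v₂ v₃ v₄ : Fin n) → Is2Switch G v₁ v₂ v₃ v₄ →
      (sliceEdges G ℓ dd i (switchAdj G v₁ v₂ v₃ v₄) ≡ sliceEdges G ℓ dd i (adj G))
    × (crossEdges G ℓ dd i (switchAdj G v₁ v₂ v₃ v₄) ≡ crossEdges G ℓ dd i (adj G))
corollary17 G ℓ dd DD forcibly i 1≤i i≤ℓ _ v₁ v₂ v₃ v₄ sw =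
    trans (sliceEdges-edgeCount G ℓ dd i _)
      (trans (sameEdges (sliceMask P Q) (sliceMask-symmetric P Q) (sliceMask-invariant P Q))
        (sym (sliceEdges-edgeCount G ℓ dd i (adj G))))
  , sameEdges (crossMask P Q) (crossMask-symmetric P Q) (crossMask-invariant P Q)
  where
  H : Graph _
  H = switched G sw
  scG : SelfComplementary G
  scG = forcibly G (idₚ , λ _ → refl)
  scH : SelfComplementary H
  scH = forcibly H (idₚ , deg-switched G sw)
  P Q : Fin _ → Bool
  P = inV G dd i
  Q = inV G dd (suc ℓ ∸ i)

  sameEdges : ∀ M → Symmetric M → (∀ σ → Swaps σ P Q → Invariant σ M) →
    edgeCount (M ∩ adj H) ≡ edgeCount (M ∩ adj G)
  sameEdges M sym-M invariant = selfComplementary-edgeCount {K₁ = H} {G} scH scG M sym-M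
    (invariant (proj₁ scH) (degreeClasses-swap G H dd scH (deg-switched G sw) classes))
    (invariant (proj₁ scG) (degreeClasses-swap G G dd scG (λ _ → refl) classes))
    where classes = complementaryDegrees G ℓ dd DD scG (1≤i , i≤ℓ)
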